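{- Let $\mathcal{G}$ be an undirected connected graph without loops on $C=\{1,\dots,L\}$ and let $k\ge 1$ be an integer. Then the fixed points of $N^k$ are in one-to-one correspondence with the $k$-minimal transversals of the hypergraph $\mathcal{H}(k)$, and so are the fixed points of $F^k$.
   Context: For $i\in C$ let $S(i)$ be the set of neighbours of $i$ in $\mathcal{G}$. $\mathbb{B}=\{0,1\}$. Define $F^k\colon\mathbb{B}^{2L}\to\mathbb{B}^{2L}$, writing states as $(n,d)=(n_1,\dots,n_L,d_1,\dots,d_L)$, by $F^k_i(n,d)=1$ iff $\sum_{j\in S(i)}d_j\ge k$, and $F^k_{i+L}(n,d)=1-n_i$, for $i\in C$. Define $N^k\colon\mathbb{B}^L\to\mathbb{B}^L$ by $N^k_i(n)=1$ iff $\sum_{j\in S(i)}(1-n_j)\ge k$. A fixed point of a map $f$ is $x$ with $f(x)=x$. The hypergraph $\mathcal{H}(k)$ has vertex set $C$ and edge set $\{\{i\}\cup H : i\in C,\ H\subseteq S(i),\ |H|=k\}$. A transversal of $\mathcal{H}(k)$ is a set $Q\subseteq C$ meeting every edge. A transversal $Q$ is $k$-minimal if $|S(i)\cap Q|\le |S(i)|-k$ for every $i\in Q$. -}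

module Defs where

open import Data.Bool using (Bool; true; false; not)
open import Data.Nat using (ℕ; _≤_; _+_; _≤?_)
open import Data.Fin using (Fin)
open import Data.Fin.Subset using (Subset; _∩_; ∁; ∣_∣; _⊆_; _∈_)
open import Data.Vec using (Vec; tabulate; map)
open import Data.Product using (Σ; _×_; _,_)
open import Data.Sum using (_⊎_)
open import Relation.Nullary using (does)
open import Relation.Binary.PropositionalEquality using (_≡_)

Adj : ℕ → Set
Adj L = Fin L → Fin L → Bool

Symmetric : ∀ {L} → Adj L → Set
Symmetric A = ∀ i j → A i j ≡ A j i

Loopless : ∀ {L} → Adj L → Set
Loopless A = ∀ i → A i i ≡ false

data Reach {L} (A : Adj L) : Fin L → Fin L → Set where
  here : ∀ {i} → Reach A i i
  step : ∀ {i j l} → A i j ≡ true → Reach A j l → Reach A i l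

Connected : ∀ {L} → Adj L → Set
Connected A = ∀ i j → Reach A i j

S : ∀ {L} → Adj L → Fin L → Subset L
S A i = tabulate (A i)

-- N^k : B^L → B^L,  N^k_i(n) = 1 iff Σ_{j∈S(i)} (1 - n_j) ≥ k
Nk : ∀ {L} → Adj L → ℕ → Vec Bool L → Vec Bool L
Nk A k n = tabulate (λ i → does (k ≤? ∣ S A i ∩ ∁ n ∣))

Fk : ∀ {L} → Adj L → ℕ → Vec Bool L × Vec Bool L → Vec Bool L × Vec Bool L
Fk A k (n , d) = tabulate (λ i → does (k ≤? ∣ S A i ∩ d ∣)) , map not n

-- Edges of H(k): {i} ∪ H with H ⊆ S(i), |H| = k
IsEdge : ∀ {L} → Adj L → ℕ → Fin L → Subset L → Set
IsEdge A k i H = H ⊆ S A i × ∣ H ∣ ≡ k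

Transversal : ∀ {L} → Adj L → ℕ → Subset L → Set
Transversal A k Q = ∀ i H → IsEdge A k i H →
  Σ (Fin _) (λ j → j ∈ Q × (j ≡ i ⊎ j ∈ H))

-- k-minimal transversal: |S(i) ∩ Q| ≤ |S(i)| - k for every i ∈ Q
-- (integer inequality, written without truncated subtraction)
KMinimalTransversal : ∀ {L} → Adj L → ℕ → Subset L → Set
KMinimalTransversal A k Q =
  Transversal A k Q × (∀ i → i ∈ Q → ∣ S A i ∩ Q ∣ + k ≤ ∣ S A i ∣)

OneToOne : ∀ {X Y : Set} → (X → Set) → (Y → Set) → Set
OneToOne {X} {Y} P Q =
  Σ (X → Y) λ f →
    (∀ x → P x → Q (f x)) ×
    (∀ x x' → P x → P x' → f x ≡ f x' → x ≡ x') ×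
    (∀ y → Q y → Σ X (λ x → P x × f x ≡ y))

-- A configuration n is fixed by N^k exactly when i ∈ n ⇔ k ≤ #(neighbours of i
-- outside n) for every vertex i. For i ∉ n this says that fewer than k neighbours
-- of i avoid n, i.e. that n meets every edge {i} ∪ H of H(k); for i ∈ n it is
-- k-minimality, once S(i) is split into its parts inside and outside n. Hence
-- the correspondence for N^k is the identity, and a fixed point (n , d) of F^k
-- is determined by n because d = ∁ n.
module Submission where

open import Defs
open import Data.Bool using (true)
open import Data.Bool.Properties using (⇔→≡)
open import Data.Nat using (ℕ; zero; suc; _≤_; _≤?_; _+_; s≤s)
open import Data.Nat.Properties using (+-suc; +-cancelˡ-≤; +-monoʳ-≤; ≤-trans; ≤-reflexive)
open import Data.Fin using (Fin)
open import Data.Fin.Subset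
  using (Subset; _∩_; ∁; ∣_∣; _⊆_; _∈_; ⊥; inside; outside)
open import Data.Fin.Subset.Properties
  using (⊥⊆; ∣⊥∣≡0; out⊆; in⊆in; p⊆q⇒∣p∣≤∣q∣; p∩q⊆p; p∩q⊆q; x∈p∩q⁺; x∈p∩q⁻;
         x∈∁p⇒x∉p; x∉p⇒x∈∁p; nonempty?)
open import Data.Vec using ([]; _∷_; lookup; tabulate)
open import Data.Vec.Properties using (lookup∘tabulate; tabulate∘lookup; tabulate-cong;
                                       []=⇒lookup; lookup⇒[]=)
open import Data.Product using (Σ; ∃-syntax; _×_; _,_; proj₁; proj₂)
open import Data.Sum using (_⊎_; inj₁; inj₂)
open import Function using (_∘_)
open import Function.Bundles using (_⇔_; mk⇔; Equivalence)
open import Function.Construct.Composition using (_⇔-∘_)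
open import Function.Construct.Symmetry using (⇔-sym)
open import Function.Construct.Identity using (⇔-id)
open import Data.Product.Function.NonDependent.Propositional using (_×-⇔_)
open import Relation.Nullary using (Dec; yes; no; does; contradiction)
open import Relation.Unary using (Decidable)
open import Relation.Binary.PropositionalEquality
  using (_≡_; refl; sym; trans; cong; module ≡-Reasoning)

open Equivalence using (to; from)

∣p∩q∣+∣p∩∁q∣≡∣p∣ : ∀ {n} (p q : Subset n) → ∣ p ∩ q ∣ + ∣ p ∩ ∁ q ∣ ≡ ∣ p ∣
∣p∩q∣+∣p∩∁q∣≡∣p∣ []            []            = refl
∣p∩q∣+∣p∩∁q∣≡∣p∣ (outside ∷ p) (_ ∷ q)       = ∣p∩q∣+∣p∩∁q∣≡∣p∣ p q
∣p∩q∣+∣p∩∁q∣≡∣p∣ (inside ∷ p)  (inside ∷ q)  = cong suc (∣p∩q∣+∣p∩∁q∣≡∣p∣ p q)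
∣p∩q∣+∣p∩∁q∣≡∣p∣ (inside ∷ p)  (outside ∷ q) =
  trans (+-suc _ _) (cong suc (∣p∩q∣+∣p∩∁q∣≡∣p∣ p q))

∣p∩q∣+k≤∣p∣⇔k≤∣p∩∁q∣ : ∀ {n} k (p q : Subset n) →
                       ∣ p ∩ q ∣ + k ≤ ∣ p ∣ ⇔ k ≤ ∣ p ∩ ∁ q ∣
∣p∩q∣+k≤∣p∣⇔k≤∣p∩∁q∣ k p q = mk⇔
  (λ le → +-cancelˡ-≤ ∣ p ∩ q ∣ k _ (≤-trans le (≤-reflexive (sym split))))
  (λ le → ≤-trans (+-monoʳ-≤ ∣ p ∩ q ∣ le) (≤-reflexive split))
  where split = ∣p∩q∣+∣p∩∁q∣≡∣p∣ p q

⊆-of-size : ∀ {n} k (p : Subset n) → k ≤ ∣ p ∣ → ∃[ q ] q ⊆ p × ∣ q ∣ ≡ k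
⊆-of-size {n} zero p _           = ⊥ , ⊥⊆ , ∣⊥∣≡0 n
⊆-of-size (suc k) (outside ∷ p) le      =
  let q , q⊆p , ∣q∣≡k = ⊆-of-size (suc k) p le in outside ∷ q , out⊆ q⊆p , ∣q∣≡k
⊆-of-size (suc k) (inside ∷ p)  (s≤s le) =
  let q , q⊆p , ∣q∣≡k = ⊆-of-size k p le in inside ∷ q , in⊆in q⊆p , cong suc ∣q∣≡k

meets⊎⊆∁ : ∀ {n} (p q : Subset n) → (∃[ x ] x ∈ p × x ∈ q) ⊎ p ⊆ ∁ q
meets⊎⊆∁ p q with nonempty? (p ∩ q)
... | yes (x , x∈p∩q) = inj₁ (x , x∈p∩q⁻ p q x∈p∩q)
... | no  p∩q-empty   =
  inj₂ λ x∈p → x∉p⇒x∈∁p λ x∈q → p∩q-empty (_ , x∈p∩q⁺ (x∈p , x∈q))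

does≡true⇔ : ∀ {P : Set} (P? : Dec P) → does P? ≡ true ⇔ P
does≡true⇔ (yes p)  = mk⇔ (λ _ → p) (λ _ → refl)
does≡true⇔ (no ¬p)  = mk⇔ (λ ()) (λ p → contradiction p ¬p)

∈⇔lookup≡true : ∀ {n} {i : Fin n} (q : Subset n) → i ∈ q ⇔ lookup q i ≡ true
∈⇔lookup≡true q = mk⇔ []=⇒lookup (lookup⇒[]= _ q)

tabulate-does≡⇔ : ∀ {n} {P : Fin n → Set} (P? : Decidable P) (q : Subset n) →
                  tabulate (does ∘ P?) ≡ q ⇔ (∀ i → i ∈ q ⇔ P i)
tabulate-does≡⇔ {P = P} P? q = mk⇔ members extensionality
  where
  ∈-tabulate : ∀ i → i ∈ tabulate (does ∘ P?) ⇔ P i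
  ∈-tabulate i =
    does≡true⇔ (P? i) ⇔-∘
    (mk⇔ (trans (sym (lookup∘tabulate _ i))) (trans (lookup∘tabulate _ i)) ⇔-∘
     ∈⇔lookup≡true (tabulate (does ∘ P?)))

  members : tabulate (does ∘ P?) ≡ q → ∀ i → i ∈ q ⇔ P i
  members refl = ∈-tabulate

  extensionality : (∀ i → i ∈ q ⇔ P i) → tabulate (does ∘ P?) ≡ q
  extensionality q≡P = begin
    tabulate (does ∘ P?)  ≡⟨ tabulate-cong (λ i → ⇔→≡ (same-truth i)) ⟩
    tabulate (lookup q)   ≡⟨ tabulate∘lookup q ⟩
    q                     ∎
    where
    open ≡-Reasoning
    same-truth : ∀ i → does (P? i) ≡ true ⇔ lookup q i ≡ true
    same-truth i = ∈⇔lookup≡true q ⇔-∘ (⇔-sym (q≡P i) ⇔-∘ does≡true⇔ (P? i))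

oneToOne-id : ∀ {X : Set} {P Q : X → Set} → (∀ x → P x ⇔ Q x) → OneToOne P Q
oneToOne-id P⇔Q =
  (λ x → x) , (to ∘ P⇔Q) , (λ _ _ _ _ eq → eq) , λ y Qy → y , from (P⇔Q y) Qy , refl

oneToOne-proj₁ : ∀ {X Y : Set} {P : X × Y → Set} {Q : X → Set} (g : X → Y) →
                 (∀ x y → P (x , y) ⇔ (Q x × y ≡ g x)) → OneToOne P Q
oneToOne-proj₁ {P = P} {Q} g P⇔Q = proj₁ , preserves , injective , surjective
  where
  preserves : ∀ s → P s → Q (proj₁ s)
  preserves (x , y) Ps = proj₁ (to (P⇔Q x y) Ps)

  injective : ∀ s s' → P s → P s' → proj₁ s ≡ proj₁ s' → s ≡ s'
  injective (x , y) (.x , y') Ps Ps' refl =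
    cong (x ,_) (trans (proj₂ (to (P⇔Q x y) Ps)) (sym (proj₂ (to (P⇔Q x y') Ps'))))

  surjective : ∀ x → Q x → Σ _ λ s → P s × proj₁ s ≡ x
  surjective x Qx = (x , g x) , from (P⇔Q x (g x)) (Qx , refl) , refl

module _ {L : ℕ} (A : Adj L) (k : ℕ) where

  Stable : Subset L → Set
  Stable Q = ∀ i → i ∈ Q ⇔ k ≤ ∣ S A i ∩ ∁ Q ∣

  Nk-fixed⇔stable : ∀ Q → Nk A k Q ≡ Q ⇔ Stable Q
  Nk-fixed⇔stable Q = tabulate-does≡⇔ (λ i → k ≤? ∣ S A i ∩ ∁ Q ∣) Q

  stable⇒transversal : ∀ {Q} → Stable Q → Transversal A k Q
  stable⇒transversal {Q} stable i H (H⊆Si , ∣H∣≡k) with meets⊎⊆∁ H Q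
  ... | inj₁ (j , j∈H , j∈Q) = j , j∈Q , inj₂ j∈H
  ... | inj₂ H⊆∁Q            = i , from (stable i) k≤∣Si∩∁Q∣ , inj₁ refl
    where
    k≤∣Si∩∁Q∣ : k ≤ ∣ S A i ∩ ∁ Q ∣
    k≤∣Si∩∁Q∣ = ≤-trans (≤-reflexive (sym ∣H∣≡k))
                        (p⊆q⇒∣p∣≤∣q∣ λ x∈H → x∈p∩q⁺ (H⊆Si x∈H , H⊆∁Q x∈H))

  stable⇒kMinimalTransversal : ∀ {Q} → Stable Q → KMinimalTransversal A k Q
  stable⇒kMinimalTransversal {Q} stable =
    stable⇒transversal stable ,
    λ i i∈Q → from (∣p∩q∣+k≤∣p∣⇔k≤∣p∩∁q∣ k (S A i) Q) (to (stable i) i∈Q)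

  kMinimalTransversal⇒stable : ∀ {Q} → KMinimalTransversal A k Q → Stable Q
  kMinimalTransversal⇒stable {Q} (transversal , minimal) i =
    mk⇔ (to (∣p∩q∣+k≤∣p∣⇔k≤∣p∩∁q∣ k (S A i) Q) ∘ minimal i) in-Q
    where
    -- k neighbours of i outside Q form an edge with i, which Q can only meet in i.
    in-Q : k ≤ ∣ S A i ∩ ∁ Q ∣ → i ∈ Q
    in-Q k≤ with ⊆-of-size k (S A i ∩ ∁ Q) k≤
    ... | H , H⊆ , ∣H∣≡k with transversal i H (p∩q⊆p _ _ ∘ H⊆ , ∣H∣≡k)
    ...   | j , j∈Q , inj₁ refl = j∈Q
    ...   | j , j∈Q , inj₂ j∈H  = contradiction j∈Q (x∈∁p⇒x∉p (p∩q⊆q _ _ (H⊆ j∈H)))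

  Nk-fixed⇔kMinimalTransversal : ∀ Q → Nk A k Q ≡ Q ⇔ KMinimalTransversal A k Q
  Nk-fixed⇔kMinimalTransversal Q =
    mk⇔ stable⇒kMinimalTransversal kMinimalTransversal⇒stable ⇔-∘ Nk-fixed⇔stable Q

  Fk-fixed⇔ : ∀ n d → Fk A k (n , d) ≡ (n , d) ⇔ (Nk A k n ≡ n × d ≡ ∁ n)
  Fk-fixed⇔ n d = mk⇔ split join
    where
    split : Fk A k (n , d) ≡ (n , d) → Nk A k n ≡ n × d ≡ ∁ n
    split eq with sym (cong proj₂ eq)
    ... | refl = cong proj₁ eq , refl

    join : Nk A k n ≡ n × d ≡ ∁ n → Fk A k (n , d) ≡ (n , d)
    join (fixed , refl) = cong (_, ∁ n) fixed

theorem11 : (L : ℕ) (A : Adj L) → Symmetric A → Loopless A → Connected A →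
    (k : ℕ) → 1 ≤ k →
    OneToOne (λ n → Nk A k n ≡ n) (KMinimalTransversal A k)
      × OneToOne (λ s → Fk A k s ≡ s) (KMinimalTransversal A k)
theorem11 L A _ _ _ k _ =
  oneToOne-id (Nk-fixed⇔kMinimalTransversal A k) ,
  oneToOne-proj₁ ∁ λ n d →
    (Nk-fixed⇔kMinimalTransversal A k n ×-⇔ ⇔-id _) ⇔-∘ Fk-fixed⇔ A k n d
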